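{- Let $G$ and $H$ be graphs. Then $\mathcal{R}(G\cup H)\cong \mathcal{R}(G)\,\square\,\mathcal{R}(H)$, where $G\cup H$ is the disjoint union.
   Context: All graphs are finite, simple and undirected; $N(v)$ denotes the open neighbourhood of $v$. A set $S\subseteq V(G)$ is a dominating set if every vertex of $G$ is in $S$ or adjacent to a vertex of $S$; it is a minimal dominating set if no proper subset of $S$ is a dominating set. The reconfiguration graph $\mathcal{R}(G)$ has as vertex set the collection of all minimal dominating sets of $G$, and two minimal dominating sets $M_1,M_2$ are adjacent iff there is a vertex $v$ with either ($M_2\setminus M_1=\{v\}$ and $M_1\setminus M_2\subseteq N(v)$) or ($M_1\setminus M_2=\{v\}$ and $M_2\setminus M_1\subseteq N(v)$). The Cartesian product $A\,\square\,B$ has vertex set $V(A)\times V(B)$, with $(a,b)\sim(a',b')$ iff either $a=a'$ and $b\sim b'$ in $B$, or $b=b'$ and $a\sim a'$ in $A$. -}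

module Defs where

open import Data.Nat using (ℕ; _+_)
open import Data.Bool using (Bool; true; false)
open import Data.Fin using (Fin; splitAt)
open import Data.Fin.Subset using (Subset; _∈_; _⊆_; _⊂_; _─_; ⁅_⁆)
open import Data.Sum using (_⊎_; inj₁; inj₂)
open import Data.Product using (Σ; ∃; _×_; _,_)
open import Data.Vec using (tabulate)
open import Relation.Binary.PropositionalEquality using (_≡_)
open import Relation.Nullary using (¬_)
open import Function.Bundles using (_↔_; _⇔_; Inverse)

record FinGraph : Set where
  field
    n     : ℕ
    adj   : Fin n → Fin n → Bool
    sym   : ∀ u v → adj u v ≡ adj v u
    irref : ∀ v → adj v v ≡ false
open FinGraph public

N : (G : FinGraph) → Fin (n G) → Subset (n G)
N G v = tabulate (λ u → adj G v u)

IsDominating : (G : FinGraph) → Subset (n G) → Set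
IsDominating G S = ∀ v → (v ∈ S) ⊎ (∃ λ u → u ∈ S × adj G u v ≡ true)

IsMinDom : (G : FinGraph) → Subset (n G) → Set
IsMinDom G S = IsDominating G S × (∀ T → T ⊂ S → ¬ IsDominating G T)

record Graph : Set₁ where
  field
    V : Set
    E : V → V → Set
open Graph public

-- vertices of the reconfiguration graph: minimal dominating sets
-- (the minimality proof is irrelevant, so a vertex is determined by its set)
record MDS (G : FinGraph) : Set where
  constructor mds
  field
    set    : Subset (n G)
    .isMin : IsMinDom G set
open MDS public

RStep : (G : FinGraph) → Subset (n G) → Subset (n G) → Set
RStep G M₁ M₂ = ∃ λ v → ((M₂ ─ M₁) ≡ ⁅ v ⁆) × ((M₁ ─ M₂) ⊆ N G v)

R : FinGraph → Graph
R G = record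
  { V = MDS G
  ; E = λ M₁ M₂ → RStep G (set M₁) (set M₂) ⊎ RStep G (set M₂) (set M₁)
  }

_□_ : Graph → Graph → Graph
A □ B = record
  { V = V A × V B
  ; E = λ { (a , b) (a' , b') → (a ≡ a' × E B b b') ⊎ (b ≡ b' × E A a a') }
  }

unionAdj : (G H : FinGraph) → Fin (n G + n H) → Fin (n G + n H) → Bool
unionAdj G H i j with splitAt (n G) i | splitAt (n G) j
... | inj₁ a | inj₁ b = adj G a b
... | inj₂ a | inj₂ b = adj H a b
... | inj₁ _ | inj₂ _ = false
... | inj₂ _ | inj₁ _ = false

unionSym : (G H : FinGraph) → ∀ u v → unionAdj G H u v ≡ unionAdj G H v u
unionSym G H u v with splitAt (n G) u | splitAt (n G) v
... | inj₁ a | inj₁ b = sym G a b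
... | inj₂ a | inj₂ b = sym H a b
... | inj₁ _ | inj₂ _ = Relation.Binary.PropositionalEquality.refl
... | inj₂ _ | inj₁ _ = Relation.Binary.PropositionalEquality.refl

unionIrref : (G H : FinGraph) → ∀ v → unionAdj G H v v ≡ false
unionIrref G H v with splitAt (n G) v
... | inj₁ a = irref G a
... | inj₂ a = irref H a

_⊔G_ : FinGraph → FinGraph → FinGraph
G ⊔G H = record
  { n = n G + n H ; adj = unionAdj G H ; sym = unionSym G H ; irref = unionIrref G H }

_≅_ : Graph → Graph → Set
A ≅ B = Σ (V A ↔ V B) λ f →
  ∀ x y → E A x y ⇔ E B (Inverse.to f x) (Inverse.to f y)

-- A set S ⊆ V(G) ⊎ V(H) is A ++ B with A ⊆ V(G) and B ⊆ V(H), and since no edge joins the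
-- two components, S dominates G ⊔ H iff A dominates G and B dominates H. Minimality
-- decouples too: a proper dominating subset of A ++ B is proper in one component and
-- dominating in both. A reconfiguration step adds one vertex v and removes only
-- neighbours of v; v has no neighbours in the other component, which therefore stays
-- fixed. So the steps of R(G ⊔ H) are exactly the steps of R(G) or of R(H) with the other
-- coordinate fixed, i.e. the edges of R(G) □ R(H).
module Submission where

open import Defs hiding (sym)

open import Data.Bool using (false; true)
open import Data.Empty using (⊥-elim)
open import Data.Fin using (Fin; zero; suc; _↑ˡ_; _↑ʳ_)
open import Data.Fin.Properties using (splitAt-↑ˡ; splitAt-↑ʳ)
open import Data.Fin.Subset using (Subset; inside; outside; _∈_; _⊆_; _⊂_; _─_; ⁅_⁆)
  renaming (⊥ to ∅)
open import Data.Fin.Subset.Properties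
  using (∉⊥; ⊆-antisym; ⊆-reflexive; ⊆-trans; x∈p∧x∉q⇒x∈p─q; _∈?_)
open import Data.Nat using (ℕ; zero; suc; _+_)
open import Data.Product using (∃; _×_; _,_; proj₁; proj₂)
open import Data.Product.Function.NonDependent.Propositional using (_×-⇔_)
open import Data.Sum using (_⊎_; inj₁; inj₂)
open import Data.Sum.Function.Propositional using (_⊎-⇔_)
open import Data.Vec
  using (Vec; []; _∷_; _++_; here; there; tabulate; replicate; splitAt; take; drop)
open import Data.Vec.Properties
  using (zipWith-++; ++-injective; ++-injectiveˡ; ++-injectiveʳ; tabulate-cong; take++drop≡id)
open import Function using (_∘_; id)
open import Function.Bundles using (_↔_; _⇔_; mk⇔; mk↔ₛ′; Inverse; Equivalence)
open import Function.Construct.Composition using (_⇔-∘_)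
open import Function.Construct.Identity using (⇔-id)
open import Relation.Binary.PropositionalEquality
  using (_≡_; refl; sym; trans; cong; cong₂; subst; subst₂; module ≡-Reasoning)
open import Relation.Nullary using (¬_; yes; no)

private
  variable
    m k : ℕ

data SplitAt (m k : ℕ) : Fin (m + k) → Set where
  left  : (i : Fin m) → SplitAt m k (i ↑ˡ k)
  right : (j : Fin k) → SplitAt m k (m ↑ʳ j)

splitAt-view : ∀ m k (x : Fin (m + k)) → SplitAt m k x
splitAt-view zero    k x       = right x
splitAt-view (suc m) k zero    = left zero
splitAt-view (suc m) k (suc x) with splitAt-view m k x
... | left i  = left (suc i)
... | right j = right j

tabulate-++ : ∀ m {k} {A : Set} (f : Fin (m + k) → A) →
              tabulate f ≡ tabulate (f ∘ (_↑ˡ k)) ++ tabulate (f ∘ (m ↑ʳ_))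
tabulate-++ zero    f = refl
tabulate-++ (suc m) f = cong (f zero ∷_) (tabulate-++ m (f ∘ suc))

tabulate-const : ∀ n {A : Set} (x : A) → tabulate {n = n} (λ _ → x) ≡ replicate n x
tabulate-const zero    x = refl
tabulate-const (suc n) x = cong (x ∷_) (tabulate-const n x)

take-++ : ∀ {A : Set} (xs : Vec A m) (ys : Vec A k) → take m (xs ++ ys) ≡ xs
take-++ {m = m} xs ys =
  sym (++-injectiveˡ xs (take m (xs ++ ys)) (sym (take++drop≡id m (xs ++ ys))))

drop-++ : ∀ {A : Set} (xs : Vec A m) (ys : Vec A k) → drop m (xs ++ ys) ≡ ys
drop-++ {m = m} xs ys =
  sym (++-injectiveʳ xs (take m (xs ++ ys)) (sym (take++drop≡id m (xs ++ ys))))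

∅-++ : ∀ m {k} → ∅ {m} ++ ∅ {k} ≡ ∅
∅-++ zero    = refl
∅-++ (suc m) = cong (outside ∷_) (∅-++ m)

⁅⁆-↑ˡ : ∀ {m} k (i : Fin m) → ⁅ i ↑ˡ k ⁆ ≡ ⁅ i ⁆ ++ ∅
⁅⁆-↑ˡ {suc m} k zero    = cong (inside ∷_) (sym (∅-++ m))
⁅⁆-↑ˡ         k (suc i) = cong (outside ∷_) (⁅⁆-↑ˡ k i)

⁅⁆-↑ʳ : ∀ m {k} (j : Fin k) → ⁅ m ↑ʳ j ⁆ ≡ ∅ ++ ⁅ j ⁆
⁅⁆-↑ʳ zero    j = refl
⁅⁆-↑ʳ (suc m) j = cong (outside ∷_) (⁅⁆-↑ʳ m j)

─-++ : (A A' : Subset m) (B B' : Subset k) → (A ++ B) ─ (A' ++ B') ≡ (A ─ A') ++ (B ─ B')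
─-++ A A' B B' = zipWith-++ _ A B A' B'

p─p≡∅ : (p : Subset m) → p ─ p ≡ ∅
p─p≡∅ []            = refl
p─p≡∅ (outside ∷ p) = cong (outside ∷_) (p─p≡∅ p)
p─p≡∅ (inside  ∷ p) = cong (outside ∷_) (p─p≡∅ p)

p─q⊆∅⇒p⊆q : {p q : Subset m} → p ─ q ⊆ ∅ → p ⊆ q
p─q⊆∅⇒p⊆q {q = q} p─q⊆∅ {x} x∈p with x ∈? q
... | yes x∈q = x∈q
... | no  x∉q = ⊥-elim (∉⊥ (p─q⊆∅ (x∈p∧x∉q⇒x∈p─q x∈p x∉q)))

∈-++⁺ˡ : ∀ {A : Subset m} {B : Subset k} {i} → i ∈ A → i ↑ˡ k ∈ A ++ B
∈-++⁺ˡ here      = here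
∈-++⁺ˡ (there p) = there (∈-++⁺ˡ p)

∈-++⁻ˡ : ∀ {A : Subset m} {B : Subset k} {i} → i ↑ˡ k ∈ A ++ B → i ∈ A
∈-++⁻ˡ {A = _ ∷ _} {i = zero}  here      = here
∈-++⁻ˡ {A = _ ∷ _} {i = suc i} (there p) = there (∈-++⁻ˡ p)

∈-++⁺ʳ : ∀ (A : Subset m) {B : Subset k} {j} → j ∈ B → m ↑ʳ j ∈ A ++ B
∈-++⁺ʳ []      p = p
∈-++⁺ʳ (_ ∷ A) p = there (∈-++⁺ʳ A p)

∈-++⁻ʳ : ∀ (A : Subset m) {B : Subset k} {j} → m ↑ʳ j ∈ A ++ B → j ∈ B
∈-++⁻ʳ []      p         = p
∈-++⁻ʳ (_ ∷ A) (there p) = ∈-++⁻ʳ A p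

module _ {A A' : Subset m} {B B' : Subset k} where

  ++-⊆⁺ : A ⊆ A' → B ⊆ B' → A ++ B ⊆ A' ++ B'
  ++-⊆⁺ A⊆A' B⊆B' {x} x∈ with splitAt-view m k x
  ... | left i  = ∈-++⁺ˡ (A⊆A' (∈-++⁻ˡ x∈))
  ... | right j = ∈-++⁺ʳ A' (B⊆B' (∈-++⁻ʳ A x∈))

  ++-⊆⁻ˡ : A ++ B ⊆ A' ++ B' → A ⊆ A'
  ++-⊆⁻ˡ sub = ∈-++⁻ˡ ∘ sub ∘ ∈-++⁺ˡ

  ++-⊆⁻ʳ : A ++ B ⊆ A' ++ B' → B ⊆ B'
  ++-⊆⁻ʳ sub = ∈-++⁻ʳ A' ∘ sub ∘ ∈-++⁺ʳ A

  ++-⊂⁻ : A ++ B ⊂ A' ++ B' → A ⊂ A' ⊎ B ⊂ B'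
  ++-⊂⁻ (sub , x , x∈ , x∉) with splitAt-view m k x
  ... | left i  = inj₁ (++-⊆⁻ˡ sub , i , ∈-++⁻ˡ x∈ , x∉ ∘ ∈-++⁺ˡ)
  ... | right j = inj₂ (++-⊆⁻ʳ sub , j , ∈-++⁻ʳ A' x∈ , x∉ ∘ ∈-++⁺ʳ A)

⊂-++⁺ˡ : {A A' : Subset m} {B : Subset k} → A ⊂ A' → A ++ B ⊂ A' ++ B
⊂-++⁺ˡ (sub , x , x∈ , x∉) = ++-⊆⁺ sub id , x ↑ˡ _ , ∈-++⁺ˡ x∈ , x∉ ∘ ∈-++⁻ˡ

⊂-++⁺ʳ : {A : Subset m} {B B' : Subset k} → B ⊂ B' → A ++ B ⊂ A ++ B'
⊂-++⁺ʳ {A = A} (sub , x , x∈ , x∉) = ++-⊆⁺ id sub , _ ↑ʳ x , ∈-++⁺ʳ A x∈ , x∉ ∘ ∈-++⁻ʳ A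

-- RStep G M₁ M₂ unfolds to ∃ λ v → Step M₁ M₂ ⁅ v ⁆ (N G v).
Step : Subset m → Subset m → Subset m → Subset m → Set
Step M₁ M₂ added removable = M₂ ─ M₁ ≡ added × M₁ ─ M₂ ⊆ removable

step-++ : {A A' I D : Subset m} {B B' J E : Subset k} →
          Step (A ++ B) (A' ++ B') (I ++ J) (D ++ E) ⇔ (Step A A' I D × Step B B' J E)
step-++ {A = A} {A'} {I} {D} {B} {B'} {J} {E} = mk⇔ split join
  where
  split : Step (A ++ B) (A' ++ B') (I ++ J) (D ++ E) → Step A A' I D × Step B B' J E
  split (added , removed) =
    let A'─A≡I , B'─B≡J = ++-injective (A' ─ A) I (trans (sym (─-++ A' A B' B)) added)
        removed′        = ⊆-trans (⊆-reflexive (sym (─-++ A A' B B'))) removed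
    in (A'─A≡I , ++-⊆⁻ˡ removed′) , (B'─B≡J , ++-⊆⁻ʳ removed′)
  join : Step A A' I D × Step B B' J E → Step (A ++ B) (A' ++ B') (I ++ J) (D ++ E)
  join ((A'─A≡I , A─A'⊆D) , (B'─B≡J , B─B'⊆E)) =
    trans (─-++ A' A B' B) (cong₂ _++_ A'─A≡I B'─B≡J) ,
    ⊆-trans (⊆-reflexive (─-++ A A' B B')) (++-⊆⁺ A─A'⊆D B─B'⊆E)

step-∅ : {B B' : Subset m} → Step B B' ∅ ∅ ⇔ B ≡ B'
step-∅ {B = B} = mk⇔
  (λ (B'─B≡∅ , B─B'⊆∅) → ⊆-antisym (p─q⊆∅⇒p⊆q B─B'⊆∅) (p─q⊆∅⇒p⊆q (⊆-reflexive B'─B≡∅)))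
  (λ { refl → p─p≡∅ B , ⊆-reflexive (p─p≡∅ B) })

-- IsMinDom G unfolds to Minimal (IsDominating G).
Minimal : (Subset m → Set) → Subset m → Set
Minimal P S = P S × (∀ T → T ⊂ S → ¬ P T)

minimal-++ : {P : Subset (m + k) → Set} {P₁ : Subset m → Set} {P₂ : Subset k → Set} →
             (∀ {A B} → P (A ++ B) ⇔ (P₁ A × P₂ B)) →
             ∀ {A B} → Minimal P (A ++ B) ⇔ (Minimal P₁ A × Minimal P₂ B)
minimal-++ {m = m} {P = P} {P₁} {P₂} P-++ {A} {B} = mk⇔ split join
  where
  open Equivalence
  split : Minimal P (A ++ B) → Minimal P₁ A × Minimal P₂ B
  split (PAB , minAB) =
    let P₁A , P₂B = to P-++ PAB
    in (P₁A , λ T T⊂A P₁T → minAB (T ++ B) (⊂-++⁺ˡ T⊂A) (from P-++ (P₁T , P₂B))) ,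
       (P₂B , λ T T⊂B P₂T → minAB (A ++ T) (⊂-++⁺ʳ T⊂B) (from P-++ (P₁A , P₂T)))
  join : Minimal P₁ A × Minimal P₂ B → Minimal P (A ++ B)
  join ((P₁A , minA) , (P₂B , minB)) = from P-++ (P₁A , P₂B) , minimal
    where
    minimal : ∀ T → T ⊂ A ++ B → ¬ P T
    minimal T T⊂AB PT with splitAt m T
    ... | T₁ , T₂ , refl with to P-++ PT | ++-⊂⁻ T⊂AB
    ...   | P₁T₁ , _ | inj₁ T₁⊂A = minA T₁ T₁⊂A P₁T₁
    ...   | _ , P₂T₂ | inj₂ T₂⊂B = minB T₂ T₂⊂B P₂T₂

Symmetrize : {X : Set} → (X → X → Set) → X → X → Set
Symmetrize R x y = R x y ⊎ R y x

CartesianStep : {X Y : Set} → (X → X → Set) → (Y → Y → Set) → X × Y → X × Y → Set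
CartesianStep R₁ R₂ (a , b) (a' , b') = (R₁ a a' × b ≡ b') ⊎ (a ≡ a' × R₂ b b')

symmetrize-cartesianStep :
  {X Y : Set} {R₁ : X → X → Set} {R₂ : Y → Y → Set} {a a' : X} {b b' : Y} →
  Symmetrize (CartesianStep R₁ R₂) (a , b) (a' , b') ⇔
  ((a ≡ a' × Symmetrize R₂ b b') ⊎ (b ≡ b' × Symmetrize R₁ a a'))
symmetrize-cartesianStep = mk⇔
  (λ { (inj₁ (inj₁ (r , refl))) → inj₂ (refl , inj₁ r)
     ; (inj₁ (inj₂ (refl , r))) → inj₁ (refl , inj₁ r)
     ; (inj₂ (inj₁ (r , refl))) → inj₂ (refl , inj₂ r)
     ; (inj₂ (inj₂ (refl , r))) → inj₁ (refl , inj₂ r) })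
  (λ { (inj₁ (refl , inj₁ r)) → inj₁ (inj₂ (refl , r))
     ; (inj₁ (refl , inj₂ r)) → inj₂ (inj₂ (refl , r))
     ; (inj₂ (refl , inj₁ r)) → inj₁ (inj₁ (r , refl))
     ; (inj₂ (refl , inj₂ r)) → inj₂ (inj₁ (r , refl)) })

≅-from-inverse : {A B : Graph} (f : V A ↔ V B) →
                 (∀ x y → E A (Inverse.from f x) (Inverse.from f y) ⇔ E B x y) → A ≅ B
≅-from-inverse {A} {B} f edges = f , λ x y →
  subst₂ (λ x′ y′ → E A x′ y′ ⇔ E B (to x) (to y)) (strictlyInverseʳ x) (strictlyInverseʳ y)
         (edges (to x) (to y))
  where open Inverse f

-- IsDominating G S unfolds to ∀ v → Dominates G S v.
Dominates : (G : FinGraph) → Subset (n G) → Fin (n G) → Set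
Dominates G S v = v ∈ S ⊎ ∃ λ u → u ∈ S × adj G u v ≡ true

module _ (G H : FinGraph) where

  open Equivalence

  adj-⊔-↑ˡ-↑ˡ : ∀ a b → adj (G ⊔G H) (a ↑ˡ n H) (b ↑ˡ n H) ≡ adj G a b
  adj-⊔-↑ˡ-↑ˡ a b rewrite splitAt-↑ˡ (n G) a (n H) | splitAt-↑ˡ (n G) b (n H) = refl

  adj-⊔-↑ʳ-↑ʳ : ∀ a b → adj (G ⊔G H) (n G ↑ʳ a) (n G ↑ʳ b) ≡ adj H a b
  adj-⊔-↑ʳ-↑ʳ a b rewrite splitAt-↑ʳ (n G) (n H) a | splitAt-↑ʳ (n G) (n H) b = refl

  adj-⊔-↑ˡ-↑ʳ : ∀ a b → adj (G ⊔G H) (a ↑ˡ n H) (n G ↑ʳ b) ≡ false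
  adj-⊔-↑ˡ-↑ʳ a b rewrite splitAt-↑ˡ (n G) a (n H) | splitAt-↑ʳ (n G) (n H) b = refl

  adj-⊔-↑ʳ-↑ˡ : ∀ a b → adj (G ⊔G H) (n G ↑ʳ a) (b ↑ˡ n H) ≡ false
  adj-⊔-↑ʳ-↑ˡ a b rewrite splitAt-↑ʳ (n G) (n H) a | splitAt-↑ˡ (n G) b (n H) = refl

  N-⊔-↑ˡ : ∀ i → N (G ⊔G H) (i ↑ˡ n H) ≡ N G i ++ ∅
  N-⊔-↑ˡ i = begin
    tabulate adjᵢ
      ≡⟨ tabulate-++ (n G) adjᵢ ⟩
    tabulate (adjᵢ ∘ (_↑ˡ n H)) ++ tabulate (adjᵢ ∘ (n G ↑ʳ_))
      ≡⟨ cong₂ _++_ (tabulate-cong (adj-⊔-↑ˡ-↑ˡ i)) (tabulate-cong (adj-⊔-↑ˡ-↑ʳ i)) ⟩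
    N G i ++ tabulate (λ _ → false)
      ≡⟨ cong (N G i ++_) (tabulate-const (n H) false) ⟩
    N G i ++ ∅ ∎
    where
    open ≡-Reasoning
    adjᵢ = adj (G ⊔G H) (i ↑ˡ n H)

  N-⊔-↑ʳ : ∀ j → N (G ⊔G H) (n G ↑ʳ j) ≡ ∅ ++ N H j
  N-⊔-↑ʳ j = begin
    tabulate adjⱼ
      ≡⟨ tabulate-++ (n G) adjⱼ ⟩
    tabulate (adjⱼ ∘ (_↑ˡ n H)) ++ tabulate (adjⱼ ∘ (n G ↑ʳ_))
      ≡⟨ cong₂ _++_ (tabulate-cong (adj-⊔-↑ʳ-↑ˡ j)) (tabulate-cong (adj-⊔-↑ʳ-↑ʳ j)) ⟩
    tabulate (λ _ → false) ++ N H j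
      ≡⟨ cong (_++ N H j) (tabulate-const (n G) false) ⟩
    ∅ ++ N H j ∎
    where
    open ≡-Reasoning
    adjⱼ = adj (G ⊔G H) (n G ↑ʳ j)

  dominates-⊔-↑ˡ : ∀ {A B} i → Dominates (G ⊔G H) (A ++ B) (i ↑ˡ n H) ⇔ Dominates G A i
  dominates-⊔-↑ˡ {A} {B} i = mk⇔ restrict extend
    where
    restrict : Dominates (G ⊔G H) (A ++ B) (i ↑ˡ n H) → Dominates G A i
    restrict (inj₁ i∈) = inj₁ (∈-++⁻ˡ i∈)
    restrict (inj₂ (u , u∈ , u~i)) with splitAt-view (n G) (n H) u
    ... | left a  = inj₂ (a , ∈-++⁻ˡ u∈ , trans (sym (adj-⊔-↑ˡ-↑ˡ a i)) u~i)
    ... | right b with () ← trans (sym (adj-⊔-↑ʳ-↑ˡ b i)) u~i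
    extend : Dominates G A i → Dominates (G ⊔G H) (A ++ B) (i ↑ˡ n H)
    extend (inj₁ i∈)             = inj₁ (∈-++⁺ˡ i∈)
    extend (inj₂ (a , a∈ , a~i)) = inj₂ (a ↑ˡ n H , ∈-++⁺ˡ a∈ , trans (adj-⊔-↑ˡ-↑ˡ a i) a~i)

  dominates-⊔-↑ʳ : ∀ {A B} j → Dominates (G ⊔G H) (A ++ B) (n G ↑ʳ j) ⇔ Dominates H B j
  dominates-⊔-↑ʳ {A} {B} j = mk⇔ restrict extend
    where
    restrict : Dominates (G ⊔G H) (A ++ B) (n G ↑ʳ j) → Dominates H B j
    restrict (inj₁ j∈) = inj₁ (∈-++⁻ʳ A j∈)
    restrict (inj₂ (u , u∈ , u~j)) with splitAt-view (n G) (n H) u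
    ... | left a with () ← trans (sym (adj-⊔-↑ˡ-↑ʳ a j)) u~j
    ... | right b = inj₂ (b , ∈-++⁻ʳ A u∈ , trans (sym (adj-⊔-↑ʳ-↑ʳ b j)) u~j)
    extend : Dominates H B j → Dominates (G ⊔G H) (A ++ B) (n G ↑ʳ j)
    extend (inj₁ j∈)             = inj₁ (∈-++⁺ʳ A j∈)
    extend (inj₂ (b , b∈ , b~j)) = inj₂ (n G ↑ʳ b , ∈-++⁺ʳ A b∈ , trans (adj-⊔-↑ʳ-↑ʳ b j) b~j)

  dominating-⊔ : ∀ {A B} →
                 IsDominating (G ⊔G H) (A ++ B) ⇔ (IsDominating G A × IsDominating H B)
  dominating-⊔ = mk⇔
    (λ dom → (λ i → to (dominates-⊔-↑ˡ i) (dom (i ↑ˡ n H))) ,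
             (λ j → to (dominates-⊔-↑ʳ j) (dom (n G ↑ʳ j))))
    (λ (domA , domB) x → extend domA domB (splitAt-view (n G) (n H) x))
    where
    extend : ∀ {A B x} → IsDominating G A → IsDominating H B →
             SplitAt (n G) (n H) x → Dominates (G ⊔G H) (A ++ B) x
    extend domA domB (left i)  = from (dominates-⊔-↑ˡ i) (domA i)
    extend domA domB (right j) = from (dominates-⊔-↑ʳ j) (domB j)

  minDom-⊔ : ∀ {A B} → IsMinDom (G ⊔G H) (A ++ B) ⇔ (IsMinDom G A × IsMinDom H B)
  minDom-⊔ = minimal-++ dominating-⊔

  rstep-⊔ : ∀ {A A' B B'} → RStep (G ⊔G H) (A ++ B) (A' ++ B') ⇔
            ((RStep G A A' × B ≡ B') ⊎ (A ≡ A' × RStep H B B'))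
  rstep-⊔ {A} {A'} {B} {B'} = mk⇔ split join
    where
    split : RStep (G ⊔G H) (A ++ B) (A' ++ B') →
            (RStep G A A' × B ≡ B') ⊎ (A ≡ A' × RStep H B B')
    split (v , step) with splitAt-view (n G) (n H) v
    ... | left i  =
      let stepA , stepB =
            to step-++ (subst₂ (Step (A ++ B) (A' ++ B')) (⁅⁆-↑ˡ (n H) i) (N-⊔-↑ˡ i) step)
      in inj₁ ((i , stepA) , to step-∅ stepB)
    ... | right j =
      let stepA , stepB =
            to step-++ (subst₂ (Step (A ++ B) (A' ++ B')) (⁅⁆-↑ʳ (n G) j) (N-⊔-↑ʳ j) step)
      in inj₂ (to step-∅ stepA , (j , stepB))
    join : (RStep G A A' × B ≡ B') ⊎ (A ≡ A' × RStep H B B') →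
           RStep (G ⊔G H) (A ++ B) (A' ++ B')
    join (inj₁ ((i , stepA) , B≡B')) =
      i ↑ˡ n H , subst₂ (Step (A ++ B) (A' ++ B')) (sym (⁅⁆-↑ˡ (n H) i)) (sym (N-⊔-↑ˡ i))
                        (from step-++ (stepA , from step-∅ B≡B'))
    join (inj₂ (A≡A' , (j , stepB))) =
      n G ↑ʳ j , subst₂ (Step (A ++ B) (A' ++ B')) (sym (⁅⁆-↑ʳ (n G) j)) (sym (N-⊔-↑ʳ j))
                        (from step-++ (from step-∅ A≡A' , stepB))

mds-≡ : {G : FinGraph} {M M' : MDS G} → set M ≡ set M' → M ≡ M'
mds-≡ refl = refl

set-≡⇔ : {G : FinGraph} {M M' : MDS G} → set M ≡ set M' ⇔ M ≡ M'
set-≡⇔ = mk⇔ mds-≡ (cong set)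

-- E (R G) unfolds to Symmetrize (MDSStep G).
MDSStep : (G : FinGraph) → MDS G → MDS G → Set
MDSStep G M M' = RStep G (set M) (set M')

module _ (G H : FinGraph) where

  open Equivalence

  minDom-take-drop : ∀ {S} → IsMinDom (G ⊔G H) S →
                     IsMinDom G (take (n G) S) × IsMinDom H (drop (n G) S)
  minDom-take-drop {S} S-min =
    to (minDom-⊔ G H) (subst (IsMinDom (G ⊔G H)) (sym (take++drop≡id (n G) S)) S-min)

  splitMDS : MDS (G ⊔G H) → MDS G × MDS H
  splitMDS (mds S S-min) = mds (take (n G) S) (proj₁ (minDom-take-drop S-min)) ,
                           mds (drop (n G) S) (proj₂ (minDom-take-drop S-min))

  joinMDS : MDS G × MDS H → MDS (G ⊔G H)
  joinMDS (mds A A-min , mds B B-min) = mds (A ++ B) (from (minDom-⊔ G H) (A-min , B-min))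

  MDS-⊔↔ : MDS (G ⊔G H) ↔ (MDS G × MDS H)
  MDS-⊔↔ = mk↔ₛ′ splitMDS joinMDS
    (λ (mds A _ , mds B _) → cong₂ _,_ (mds-≡ (take-++ A B)) (mds-≡ (drop-++ A B)))
    (λ M → mds-≡ (take++drop≡id (n G) (set M)))

  mdsStep-join : ∀ x y → MDSStep (G ⊔G H) (joinMDS x) (joinMDS y) ⇔
                         CartesianStep (MDSStep G) (MDSStep H) x y
  mdsStep-join x y = ((⇔-id _ ×-⇔ set-≡⇔) ⊎-⇔ (set-≡⇔ ×-⇔ ⇔-id _)) ⇔-∘ rstep-⊔ G H

  edges-join : ∀ x y → E (R (G ⊔G H)) (joinMDS x) (joinMDS y) ⇔ E (R G □ R H) x y
  edges-join x y = symmetrize-cartesianStep {R₁ = MDSStep G} {R₂ = MDSStep H}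
                   ⇔-∘ (mdsStep-join x y ⊎-⇔ mdsStep-join y x)

theorem2 : (G H : FinGraph) → R (G ⊔G H) ≅ (R G □ R H)
theorem2 G H = ≅-from-inverse (MDS-⊔↔ G H) (edges-join G H)
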